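{- Let $n\in\mathbb{N}\cup\{\infty\}$, let $V$ be a type with an equivalence $\sup:\mathsf{T}^n_U V\simeq V$, equipped with the induced relation $y\in x:=\mathrm{fib}\,\widetilde{x}\,y$. Then $(V,\in)$ has $U$-restricted $n$-separation: for every $x:V$ and every family $P:\mathrm{El}\,x\to U$ of $(n-1)$-types there is $\{x\mid P\}:V$ such that for all $z:V$, $z\in\{x\mid P\}\simeq\sum_{e:z\in x}P(z,e)$.
   Context: Homotopy type theory with univalent universes $U:\mathsf{Type}$ and function extensionality; $\infty-1=\infty$ and every type is an $\infty$-type. A map is $j$-truncated if its homotopy fibers are $j$-types; $A\hookrightarrow_j X$ is the type of $j$-truncated maps; $\mathsf{T}^n_U X:=\sum_{A:U}(A\hookrightarrow_{n-1}X)$. For $x:V$ write $\sup^{ -1}x=(\overline{x},\widetilde{x})$ with $\overline{x}:U$, $\widetilde{x}:\overline{x}\hookrightarrow_{n-1}V$; $\mathrm{fib}\,g\,y:=\sum_a g\,a=y$; $\mathrm{El}\,x:=\sum_{z:V}z\in x$. -}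

{-# OPTIONS --without-K #-}
module Defs where

open import Level using (Level; _⊔_) renaming (suc to lsuc)
open import Data.Nat using (ℕ; zero; suc)
open import Data.Unit.Polymorphic using (⊤)
open import Data.Product using (Σ; _,_; proj₁; proj₂)
open import Relation.Binary.PropositionalEquality using (_≡_)
open import Function.Properties.Inverse.HalfAdjointEquivalence public
  using (_≃_; module _≃_)

data ℕ∞ : Set where
  fin : ℕ → ℕ∞
  ∞   : ℕ∞

isContr : ∀ {a} → Set a → Set a
isContr A = Σ A (λ c → ∀ x → c ≡ x)

isOfHLevel : ∀ {a} → ℕ → Set a → Set a
isOfHLevel zero    A = isContr A
isOfHLevel (suc k) A = (x y : A) → isOfHLevel k (x ≡ y)

-- "A is an (n-1)-type" for n : ℕ ∪ {∞}, with ∞ - 1 = ∞ (every type is an ∞-type).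
-- A k-type is a type of h-level k+2, so an (n-1)-type has h-level n+1.
is-[_-1]-type : ∀ {a} → ℕ∞ → Set a → Set a
is-[ fin n -1]-type A = isOfHLevel (suc n) A
is-[ ∞ -1]-type     A = ⊤

fib : ∀ {a b} {A : Set a} {B : Set b} → (A → B) → B → Set (a ⊔ b)
fib {A = A} g y = Σ A (λ a → g a ≡ y)

_↪[_-1]_ : ∀ {a x} → Set a → ℕ∞ → Set x → Set (a ⊔ x)
A ↪[ n -1] X = Σ (A → X) (λ f → ∀ y → is-[ n -1]-type (fib f y))

T : ∀ {x} (n : ℕ∞) (ℓ : Level) → Set x → Set (lsuc ℓ ⊔ x)
T n ℓ X = Σ (Set ℓ) (λ A → A ↪[ n -1] X)

module _ {v} (n : ℕ∞) (ℓ : Level) {V : Set v} (sup : T n ℓ V ≃ V) where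
  open _≃_ sup

  carrier : V → Set ℓ
  carrier x = proj₁ (from x)

  tilde : (x : V) → carrier x → V
  tilde x = proj₁ (proj₂ (from x))

  _∈_ : V → V → Set (ℓ ⊔ v)
  y ∈ x = fib (tilde x) y

  El : V → Set (ℓ ⊔ v)
  El x = Σ V (λ z → z ∈ x)

{-# OPTIONS --without-K #-}
-- {x | P} is sup of the restriction of x̃ to the index type Σ (a : x̄) P (x̃ a , (a , refl)).
-- By path induction the fiber of the restriction over z is Σ (e : z ∈ x) P (z , e), an (n-1)-type
-- since h-levels are closed under Σ and retracts; and since sup⁻¹ (sup t) = t, membership in
-- {x | P} is exactly membership in this fiber.
module Submission where

open import Defs
open import Level using (Level)
open import Data.Product using (Σ; _,_; proj₁; proj₂)
open import Data.Nat using (ℕ; zero; suc)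
open import Data.Unit.Polymorphic using (tt)
open import Relation.Binary.PropositionalEquality using (_≡_; refl; sym; trans; cong; subst)
open import Function.Bundles using (_↔_; mk↔ₛ′; Inverse)
open import Function.Construct.Identity using (↔-id)
open import Function.Construct.Composition using (_↔-∘_)
open import Function.Properties.Inverse.HalfAdjointEquivalence using (↔⇒≃)

isOfHLevel-retract : ∀ {a b} {A : Set a} {B : Set b} (k : ℕ) (r : B → A) (s : A → B) →
  (∀ x → r (s x) ≡ x) → isOfHLevel k B → isOfHLevel k A
isOfHLevel-retract zero r s rs (c , contr) = r c , λ a → trans (cong r (contr (s a))) (rs a)
isOfHLevel-retract (suc k) r s rs hB a a' =
  isOfHLevel-retract k (λ q → trans (sym (rs a)) (trans (cong r q) (rs a'))) (cong s)
    cong-retract (hB (s a) (s a'))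
  where
  trans-sym-cancel : ∀ {ℓ} {X : Set ℓ} {x y : X} (q : x ≡ y) → trans (sym q) (trans refl q) ≡ refl
  trans-sym-cancel refl = refl

  cong-retract : ∀ p → trans (sym (rs a)) (trans (cong r (cong s p)) (rs a')) ≡ p
  cong-retract refl = trans-sym-cancel (rs a)

isOfHLevel-Σ : ∀ {a b} {A : Set a} {B : A → Set b} (k : ℕ) →
  isOfHLevel k A → (∀ a → isOfHLevel k (B a)) → isOfHLevel k (Σ A B)
isOfHLevel-Σ {B = B} zero (a₀ , contrA) hB = (a₀ , proj₁ (hB a₀)) , λ (a , b) → centre≡ (contrA a) b
  where
  centre≡ : ∀ {a} (q : a₀ ≡ a) (b : B a) → (a₀ , proj₁ (hB a₀)) ≡ (a , b)
  centre≡ refl b = cong (a₀ ,_) (proj₂ (hB a₀) b)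
isOfHLevel-Σ {B = B} (suc k) hA hB (a , b) (a' , b') =
  isOfHLevel-retract k Σ-≡-intro Σ-≡-elim Σ-≡-intro-elim
    (isOfHLevel-Σ k (hA a a') (λ p → hB a' (subst B p b) b'))
  where
  Σ-≡-intro : Σ (a ≡ a') (λ p → subst B p b ≡ b') → (a , b) ≡ (a' , b')
  Σ-≡-intro (refl , refl) = refl

  Σ-≡-elim : (a , b) ≡ (a' , b') → Σ (a ≡ a') (λ p → subst B p b ≡ b')
  Σ-≡-elim refl = refl , refl

  Σ-≡-intro-elim : ∀ e → Σ-≡-intro (Σ-≡-elim e) ≡ e
  Σ-≡-intro-elim refl = refl

is-type-Σ : ∀ {a b} (n : ℕ∞) {A : Set a} {B : A → Set b} →
  is-[ n -1]-type A → (∀ x → is-[ n -1]-type (B x)) → is-[ n -1]-type (Σ A B)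
is-type-Σ (fin k) = isOfHLevel-Σ (suc k)
is-type-Σ ∞ _ _ = tt

is-type-↔ : ∀ {a b} (n : ℕ∞) {A : Set a} {B : Set b} → A ↔ B → is-[ n -1]-type B → is-[ n -1]-type A
is-type-↔ (fin k) A↔B = isOfHLevel-retract (suc k) from to strictlyInverseʳ
  where open Inverse A↔B
is-type-↔ ∞ _ _ = tt

module _ {a b p} {A : Set a} {B : Set b} (g : A → B) (P : ∀ {y} → fib g y → Set p) where

  restrict-map : Σ A (λ x → P (x , refl)) → B
  restrict-map (x , _) = g x

  fib-restrict-map : ∀ y → fib restrict-map y ↔ Σ (fib g y) P
  fib-restrict-map y = mk↔ₛ′ to from (λ { ((x , refl) , p) → refl }) (λ { ((x , p) , refl) → refl })
    where
    to : fib restrict-map y → Σ (fib g y) P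
    to ((x , p) , refl) = (x , refl) , p

    from : Σ (fib g y) P → fib restrict-map y
    from ((x , refl) , p) = (x , p) , refl

T-restrict : ∀ {v} (n : ℕ∞) {ℓ : Level} {V : Set v} ((A , g , g-trunc) : T n ℓ V)
  (P : ∀ {y} → fib g y → Set ℓ) → (∀ {y} (e : fib g y) → is-[ n -1]-type (P e)) → T n ℓ V
T-restrict n (A , g , g-trunc) P P-trunc =
  Σ A (λ a → P (a , refl)) , restrict-map g P ,
  λ y → is-type-↔ n (fib-restrict-map g P y) (is-type-Σ n (g-trunc y) P-trunc)

fib-cong : ∀ {v} {n : ℕ∞} {ℓ : Level} {V : Set v} {t t' : T n ℓ V} → t ≡ t' →
  ∀ y → fib (proj₁ (proj₂ t)) y ↔ fib (proj₁ (proj₂ t')) y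
fib-cong refl y = ↔-id _

mainTheorem7 : ∀ {v} (ℓ : Level) (n : ℕ∞) (V : Set v) (sup : T n ℓ V ≃ V) →
    (x : V) (P : El n ℓ sup x → Set ℓ) → (∀ w → is-[ n -1]-type (P w)) →
    Σ V (λ s → ∀ z → (_∈_ n ℓ sup z s) ≃ Σ (_∈_ n ℓ sup z x) (λ e → P (z , e)))
mainTheorem7 ℓ n V sup x P P-trunc = to separated , λ z →
  ↔⇒≃ (fib-restrict-map (tilde n ℓ sup x) P′ z ↔-∘ fib-cong {n = n} (left-inverse-of separated) z)
  where
  open _≃_ sup

  P′ : ∀ {y} → _∈_ n ℓ sup y x → Set ℓ
  P′ {y} e = P (y , e)

  separated : T n ℓ V
  separated = T-restrict n (from x) P′ (λ {y} e → P-trunc (y , e))
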